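{- Let $G$ be an abelian group of order $n$. Then either the map $x\mapsto 2x$ or the map $x\mapsto 3x$ on $G$ has an image of size at least $n^{1/5}$. -}

module Defs where

open import Level using (Level; _⊔_)
open import Data.Nat using (ℕ)
open import Data.Fin using (Fin)
open import Data.Product using (Σ; ∃; _,_; proj₁)
open import Relation.Binary.Bundles using (Setoid)
open import Relation.Binary.PropositionalEquality as ≡ using (_≡_)
open import Function.Bundles using (Inverse)
open import Algebra.Bundles using (AbelianGroup)

HasSize : ∀ {c ℓ} → Setoid c ℓ → ℕ → Set (c ⊔ ℓ)
HasSize S n = Inverse S (≡.setoid (Fin n))

ImageSetoid : ∀ {c ℓ} (S : Setoid c ℓ) → (Setoid.Carrier S → Setoid.Carrier S) → Setoid (c ⊔ ℓ) ℓ
ImageSetoid S f = record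
  { Carrier       = Σ Carrier (λ y → ∃ λ x → f x ≈ y)
  ; _≈_           = λ a b → proj₁ a ≈ proj₁ b
  ; isEquivalence = record { refl = refl ; sym = sym ; trans = trans }
  }
  where open Setoid S

module _ {c ℓ} (G : AbelianGroup c ℓ) where
  open AbelianGroup G

  double : Carrier → Carrier
  double x = x ∙ x

  triple : Carrier → Carrier
  triple x = x ∙ x ∙ x

{-# OPTIONS --safe #-}
-- The map x ↦ (2x, 3x) is injective, since x = 3x − 2x. Hence n is at most
-- the number of pairs of values, m₂ m₃ ≤ max(m₂, m₃)², which is at most max(m₂, m₃)⁵.
module Submission where

open import Defs
open import Level using (Level)
open import Data.Nat using (ℕ; _≤_; _^_; _*_; zero; suc; z≤n; s≤s)
open import Data.Nat.Properties
  using (≤-trans; ≤-total; ≤-reflexive; *-monoˡ-≤; *-monoʳ-≤; *-identityʳ; ^-monoʳ-≤)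
open import Data.Sum as Sum using (_⊎_; inj₁; inj₂)
open import Data.Product using (_,_)
open import Data.Fin using (Fin; combine)
open import Data.Fin.Properties using (injective⇒≤; combine-injective)
open import Relation.Binary.Bundles using (Setoid)
open import Relation.Binary.PropositionalEquality as ≡ using (_≡_; cong)
open import Function.Bundles using (Inverse)
open import Algebra.Bundles using (AbelianGroup)
import Algebra.Properties.Group as GroupProperties

private
  variable
    c ℓ : Level

m*m≤m^5 : ∀ m → m * m ≤ m ^ 5
m*m≤m^5 zero    = z≤n
m*m≤m^5 (suc k) = ≤-trans (≤-reflexive (cong (suc k *_) (≡.sym (*-identityʳ (suc k)))))
                          (^-monoʳ-≤ (suc k) {2} {5} (s≤s (s≤s z≤n)))

m*n≤m^5⊎m*n≤n^5 : ∀ m n → m * n ≤ m ^ 5 ⊎ m * n ≤ n ^ 5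
m*n≤m^5⊎m*n≤n^5 m n with ≤-total m n
... | inj₁ m≤n = inj₂ (≤-trans (*-monoˡ-≤ n m≤n) (m*m≤m^5 n))
... | inj₂ n≤m = inj₁ (≤-trans (*-monoʳ-≤ m n≤m) (m*m≤m^5 m))

module _ {s ℓs a ℓa b ℓb} {S : Setoid s ℓs} {A : Setoid a ℓa} {B : Setoid b ℓb} where
  private
    module S = Setoid S
    module A = Setoid A
    module B = Setoid B

  size≤size*size : ∀ {n p q} (f : S.Carrier → A.Carrier) (g : S.Carrier → B.Carrier)
                 → (∀ {x y} → f x A.≈ f y → g x B.≈ g y → x S.≈ y)
                 → HasSize S n → HasSize A p → HasSize B q → n ≤ p * q
  size≤size*size {n} {p} {q} f g jointly-injective S↔ A↔ B↔ = injective⇒≤ {f = code} code-injective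
    where
    module S↔ = Inverse S↔
    module A↔ = Inverse A↔
    module B↔ = Inverse B↔

    code : Fin n → Fin (p * q)
    code i = combine (A↔.to (f (S↔.from i))) (B↔.to (g (S↔.from i)))

    code-injective : ∀ {i j} → code i ≡ code j → i ≡ j
    code-injective {i} {j} eq with combine-injective _ _ _ _ eq
    ... | f≡ , g≡ = ≡.trans (≡.sym (S↔.strictlyInverseˡ i))
                   (≡.trans (S↔.to-cong (jointly-injective f≈ g≈)) (S↔.strictlyInverseˡ j))
      where
      f≈ : f (S↔.from i) A.≈ f (S↔.from j)
      f≈ = A.trans (A.sym (A↔.strictlyInverseʳ _)) (A.trans (A↔.from-cong f≡) (A↔.strictlyInverseʳ _))
      g≈ : g (S↔.from i) B.≈ g (S↔.from j)
      g≈ = B.trans (B.sym (B↔.strictlyInverseʳ _)) (B.trans (B↔.from-cong g≡) (B↔.strictlyInverseʳ _))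

module _ (G : AbelianGroup c ℓ) where
  open AbelianGroup G
  open GroupProperties group using (∙-cancelˡ)

  double-triple-injective : ∀ {x y} → double G x ≈ double G y → triple G x ≈ triple G y → x ≈ y
  double-triple-injective {x} {y} 2x≈2y 3x≈3y = ∙-cancelˡ (x ∙ x) x y (trans 3x≈3y (sym (∙-congʳ 2x≈2y)))

lemma3p6 : ∀ {c ℓ} (G : AbelianGroup c ℓ) (n m₂ m₃ : ℕ)
             → HasSize (AbelianGroup.setoid G) n
             → HasSize (ImageSetoid (AbelianGroup.setoid G) (double G)) m₂
             → HasSize (ImageSetoid (AbelianGroup.setoid G) (triple G)) m₃
             → n ≤ m₂ ^ 5 ⊎ n ≤ m₃ ^ 5
lemma3p6 G n m₂ m₃ G↔ 2G↔ 3G↔ =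
  Sum.map (≤-trans n≤m₂m₃) (≤-trans n≤m₂m₃) (m*n≤m^5⊎m*n≤n^5 m₂ m₃)
  where
  open AbelianGroup G using (refl)
  n≤m₂m₃ : n ≤ m₂ * m₃
  n≤m₂m₃ = size≤size*size (λ x → double G x , x , refl) (λ x → triple G x , x , refl)
                          (double-triple-injective G) G↔ 2G↔ 3G↔
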